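{- Every $2$-tree belonging to the family $\mathcal E$ has a perfect $3$-cover and is $\alpha$-excellent.
   Context: All graphs are finite and simple. A $2$-tree is a graph obtainable from $K_2$ by finitely many applications of the operation: add a new vertex and join it to both ends of an existing edge. A triangle is a set of three mutually adjacent vertices $a,b,c$, written $abc$. A perfect $3$-cover of $G$ is a set of triangles of $G$ such that every vertex of $G$ lies in exactly one of them. $\alpha(G)$ is the independence number; an $\alpha$-set is an independent set of size $\alpha(G)$; $G$ is $\alpha$-excellent if every vertex lies in some $\alpha$-set. The family $\mathcal E$ consists of $2$-trees $G$ in which every triangle carries a label $R$ (red) or $B$ (blue); $R(G)$ and $B(G)$ denote the sets of red and blue triangles. It is defined recursively: (1) the $2$-tree of order $3$ whose only triangle is red belongs to $\mathcal E$; (2) $\mathcal E$ is closed under the operations $\mathcal O_1,\mathcal O_2$: - $\mathcal O_1(v_1,v_2)$: for $G'\in\mathcal E$ and an edge $v_1v_2$ of $G'$, add three new vertices $u_1,u_2,u_3$ so that $v_1v_2u_1$, $v_2u_1u_2$, $u_1u_2u_3$ are new triangles (i.e. $u_1$ adjacent to $v_1,v_2$; $u_2$ adjacent to $v_2,u_1$; $u_3$ adjacent to $u_1,u_2$), with $R(G)=R(G')\cup\{u_1u_2u_3\}$ and $B(G)=B(G')\cup\{v_1v_2u_1,v_2u_1u_2\}$. - $\mathcal O_2(v_1v_2,v_3v_4)$: for $G'\in\mathcal E$, a red triangle $v_1v_2v_3\in R(G')$, and a neighbor $v_4$ of $v_3$ in $G'$ (possibly $v_4\in\{v_1,v_2\}$),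 add three new vertices $u_0,u_1,u_2$ so that $u_0v_1v_2$, $v_3v_4u_1$, $v_3u_1u_2$ are new triangles, with $R(G)=(R(G')\setminus\{v_1v_2v_3\})\cup\{u_0v_1v_2, v_3u_1u_2\}$ and $B(G)=B(G')\cup\{v_1v_2v_3, v_3v_4u_1\}$. A (unlabeled) $2$-tree belongs to $\mathcal E$ if it is the underlying graph of some member of $\mathcal E$. -}

module Defs where

open import Data.Nat using (ℕ; zero; suc; _+_; _<_; _≤_; _≡ᵇ_)
open import Data.Bool using (Bool; _∨_)
open import Data.Product using (_×_; _,_; Σ; ∃; ∃-syntax)
open import Data.Sum using (_⊎_)
open import Data.List using (List; []; _∷_; _++_; length; filterᵇ)
open import Data.List.Membership.Propositional using (_∈_)
open import Data.List.Relation.Unary.All using (All)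
open import Data.List.Relation.Unary.Any using (_─_)
open import Data.List.Relation.Unary.AllPairs using (AllPairs)
open import Relation.Binary.PropositionalEquality using (_≡_; _≢_)
open import Relation.Nullary using (¬_)

-- Graphs: vertex set {0,…,n-1}, edges given by a list of pairs;
-- adjacency is symmetric closure of the edge list.

Edge : Set
Edge = ℕ × ℕ

Adj : List Edge → ℕ → ℕ → Set
Adj E u v = (u , v) ∈ E ⊎ (v , u) ∈ E

Tri : Set
Tri = ℕ × ℕ × ℕ

-- "t is the triangle {v1,v2,v3} with v3 as the distinguished vertex"
data Split : Tri → ℕ → ℕ → ℕ → Set where
  split₃ : ∀ {a b c} → Split (a , b , c) a b c
  split₁ : ∀ {a b c} → Split (a , b , c) b c a
  split₂ : ∀ {a b c} → Split (a , b , c) a c b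

-- InE n E R B : the graph on {0,…,n-1} with edge list E, red triangles R
-- and blue triangles B is a member of 𝓔.

data InE : ℕ → List Edge → List Tri → List Tri → Set where
  base : InE 3 ((0 , 1) ∷ (0 , 2) ∷ (1 , 2) ∷ []) ((0 , 1 , 2) ∷ []) []
  op₁  : ∀ {n E R B} v₁ v₂ → InE n E R B → Adj E v₁ v₂ →
         let u₁ = n ; u₂ = n + 1 ; u₃ = n + 2 in
         InE (n + 3)
             ((v₁ , u₁) ∷ (v₂ , u₁) ∷ (v₂ , u₂) ∷ (u₁ , u₂) ∷ (u₁ , u₃) ∷ (u₂ , u₃) ∷ E)
             ((u₁ , u₂ , u₃) ∷ R)
             ((v₁ , v₂ , u₁) ∷ (v₂ , u₁ , u₂) ∷ B)
  op₂  : ∀ {n E R B} {t : Tri} (p : t ∈ R) v₁ v₂ v₃ v₄ →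
         InE n E R B → Split t v₁ v₂ v₃ → Adj E v₃ v₄ →
         let u₀ = n ; u₁ = n + 1 ; u₂ = n + 2 in
         InE (n + 3)
             ((u₀ , v₁) ∷ (u₀ , v₂) ∷ (v₃ , u₁) ∷ (v₄ , u₁) ∷ (v₃ , u₂) ∷ (u₁ , u₂) ∷ E)
             ((u₀ , v₁ , v₂) ∷ (v₃ , u₁ , u₂) ∷ (R ─ p))
             ((v₁ , v₂ , v₃) ∷ (v₃ , v₄ , u₁) ∷ B)

InFamilyE : ℕ → List Edge → Set
InFamilyE n E = ∃[ R ] ∃[ B ] InE n E R B

IsTriangle : List Edge → Tri → Set
IsTriangle E (a , b , c) = Adj E a b × Adj E b c × Adj E a c

inTriᵇ : ℕ → Tri → Bool
inTriᵇ v (a , b , c) = (v ≡ᵇ a) ∨ (v ≡ᵇ b) ∨ (v ≡ᵇ c)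

occurrences : ℕ → List Tri → ℕ
occurrences v T = length (filterᵇ (inTriᵇ v) T)

PerfectThreeCover : ℕ → List Edge → List Tri → Set
PerfectThreeCover n E T =
  All (IsTriangle E) T × (∀ v → v < n → occurrences v T ≡ 1)

Independent : ℕ → List Edge → List ℕ → Set
Independent n E S =
  All (_< n) S × AllPairs _≢_ S × AllPairs (λ a b → ¬ Adj E a b) S

AlphaSet : ℕ → List Edge → List ℕ → Set
AlphaSet n E S =
  Independent n E S × (∀ S′ → Independent n E S′ → length S′ ≤ length S)

AlphaExcellent : ℕ → List Edge → Set
AlphaExcellent n E = ∀ v → v < n → ∃[ S ] (AlphaSet n E S × v ∈ S)

{-# OPTIONS --safe #-}
-- Along the construction of a member of 𝓔 we maintain: the red triangles form a perfect
-- 3-cover, every edge has a common neighbour, and every vertex lies in an independent set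
-- with as many vertices as there are red triangles.  An independent set meets each triangle
-- of a perfect 3-cover at most once, so no independent set is larger and those sets are
-- α-sets.  Each operation adds three vertices and one red triangle net; an independent set
-- of the old graph through a vertex, or avoiding both ends of an edge (take one through a
-- common neighbour), grows by a new vertex whose old neighbours it avoids.
module Submission where

open import Defs
open import Data.Nat using (ℕ; zero; suc; _+_; _<_; _≤_; _≡ᵇ_; _<ᵇ_; z≤n; s≤s; z<s)
open import Data.Nat.Properties
open import Data.Nat.Solver using (module +-*-Solver)
open import Data.Bool using (Bool; true; false; T; _∨_)
open import Data.Bool.Properties using (∨-comm; ∨-assoc; T-∨)
open import Data.Unit using (tt)
open import Data.Product using (_×_; _,_; ∃-syntax; proj₁; proj₂)
open import Data.Sum as Sum using (_⊎_; inj₁; inj₂; [_,_]′)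
open import Data.List using (List; []; _∷_; _++_; length; filterᵇ)
open import Data.List.Properties using (length-removeAt′)
open import Data.List.Membership.Propositional using (_∈_; _∉_)
open import Data.List.Membership.Propositional.Properties using (∈-++⁺ʳ; ∈-++⁻)
open import Data.List.Relation.Unary.All as All using (All; []; _∷_)
open import Data.List.Relation.Unary.All.Properties using (─⁺; ¬Any⇒All¬)
open import Data.List.Relation.Unary.Any using (Any; here; there; _─_; index)
open import Data.List.Relation.Unary.AllPairs as AllPairs using (AllPairs; []; _∷_)
open import Data.Empty using (⊥; ⊥-elim)
open import Function using (_∘_; case_of_)
open import Function.Bundles using (Equivalence)
open import Relation.Binary.PropositionalEquality
open import Relation.Nullary using (¬_; yes; no)
open import Data.List.Membership.DecPropositional _≟_ using (_∈?_)
open import Algebra.Properties.CommutativeSemigroup +-commutativeSemigroup using (x∙yz≈y∙xz)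

open Equivalence using (to)

data OldOrNew (n : ℕ) : ℕ → Set where
  old  : ∀ {v} → v < n → OldOrNew n v
  new₀ : OldOrNew n n
  new₁ : OldOrNew n (n + 1)
  new₂ : OldOrNew n (n + 2)

oldOrNew : ∀ n {v} → v < n + 3 → OldOrNew n v
oldOrNew zero {0} _ = new₀
oldOrNew zero {1} _ = new₁
oldOrNew zero {2} _ = new₂
oldOrNew zero {suc (suc (suc v))} (s≤s (s≤s (s≤s ())))
oldOrNew (suc n) {zero} _ = old z<s
oldOrNew (suc n) {suc v} (s≤s v<n+3) with oldOrNew n v<n+3
... | old v<n = old (s≤s v<n)
... | new₀ = new₀
... | new₁ = new₁
... | new₂ = new₂

<⇒<+3 : ∀ {v n} → v < n → v < n + 3
<⇒<+3 = m≤n⇒m≤n+o 3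

n<n+3 : ∀ n → n < n + 3
n<n+3 n = m<m+n n z<s

n+1<n+3 : ∀ n → n + 1 < n + 3
n+1<n+3 n = +-monoʳ-< n (s≤s (s≤s z≤n))

n+2<n+3 : ∀ n → n + 2 < n + 3
n+2<n+3 n = +-monoʳ-< n (s≤s (s≤s (s≤s z≤n)))

n≢n+1 : ∀ n → n ≢ n + 1
n≢n+1 n = <⇒≢ (m<m+n n z<s)

n≢n+2 : ∀ n → n ≢ n + 2
n≢n+2 n = <⇒≢ (m<m+n n z<s)

n+1≢n+2 : ∀ n → n + 1 ≢ n + 2
n+1≢n+2 n n+1≡n+2 with +-cancelˡ-≡ n 1 2 n+1≡n+2
... | ()

<-≤⇒≢ : ∀ {v n u} → v < n → n ≤ u → v ≢ u
<-≤⇒≢ v<n n≤u refl = <⇒≱ v<n n≤u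

ValidEdge : ℕ → Edge → Set
ValidEdge n (a , b) = a < n × b < n × a ≢ b

module _ {E : List Edge} where

  adj-sym : ∀ {a b} → Adj E a b → Adj E b a
  adj-sym = Sum.swap

  adj-valid : ∀ {n a b} → All (ValidEdge n) E → Adj E a b → a < n × b < n × a ≢ b
  adj-valid valid (inj₁ ab∈E) = All.lookup valid ab∈E
  adj-valid valid (inj₂ ba∈E) with All.lookup valid ba∈E
  ... | b<n , a<n , b≢a = a<n , b<n , ≢-sym b≢a

  adj-++⁺ʳ : ∀ es {a b} → Adj E a b → Adj (es ++ E) a b
  adj-++⁺ʳ es = Sum.map (∈-++⁺ʳ es) (∈-++⁺ʳ es)

  adj-++⁻ : ∀ es {a b} → Adj (es ++ E) a b → Adj es a b ⊎ Adj E a b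
  adj-++⁻ es (inj₁ ab∈) = Sum.map inj₁ inj₁ (∈-++⁻ es ab∈)
  adj-++⁻ es (inj₂ ba∈) = Sum.map inj₂ inj₂ (∈-++⁻ es ba∈)

  triangle-++⁺ʳ : ∀ es {t} → IsTriangle E t → IsTriangle (es ++ E) t
  triangle-++⁺ʳ es (ab , bc , ac) = adj-++⁺ʳ es ab , adj-++⁺ʳ es bc , adj-++⁺ʳ es ac

pattern ∈₁ = here refl
pattern ∈₂ = there ∈₁
pattern ∈₃ = there ∈₂
pattern ∈₄ = there ∈₃
pattern ∈₅ = there ∈₄
pattern ∈₆ = there ∈₅

CommonNeighbour : List Edge → ℕ → ℕ → Set
CommonNeighbour E x y = ∃[ z ] Adj E x z × Adj E y z

common-++ : ∀ es {E} → (∀ {x y} → Adj E x y → CommonNeighbour E x y) →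
            (∀ {x y} → (x , y) ∈ es → CommonNeighbour (es ++ E) x y) →
            ∀ {x y} → Adj (es ++ E) x y → CommonNeighbour (es ++ E) x y
common-++ es common common-new xy with adj-++⁻ es xy
... | inj₁ (inj₁ xy∈es) = common-new xy∈es
... | inj₁ (inj₂ yx∈es) = let z , yz , xz = common-new yx∈es in z , xz , yz
... | inj₂ xy-old       = let z , xz , yz = common xy-old in z , adj-++⁺ʳ es xz , adj-++⁺ʳ es yz

⟦_⟧ : Bool → ℕ
⟦ true ⟧ = 1
⟦ false ⟧ = 0

≡ᵇ-true⇒≡ : ∀ {v w} → (v ≡ᵇ w) ≡ true → v ≡ w
≡ᵇ-true⇒≡ {v} {w} eq = ≡ᵇ⇒≡ v w (subst T (sym eq) tt)

inTriᵇ⇒ : ∀ {v a b c} → T (inTriᵇ v (a , b , c)) → v ≡ a ⊎ v ≡ b ⊎ v ≡ c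
inTriᵇ⇒ {v} {a} {b} {c} v∈t =
  Sum.map (≡ᵇ⇒≡ v a) (Sum.map (≡ᵇ⇒≡ v b) (≡ᵇ⇒≡ v c) ∘ to T-∨) (to T-∨ v∈t)

⟦inTriᵇ⟧ : ∀ {a b c} → a ≢ b → b ≢ c → a ≢ c → ∀ v →
           ⟦ inTriᵇ v (a , b , c) ⟧ ≡ ⟦ v ≡ᵇ a ⟧ + ⟦ v ≡ᵇ b ⟧ + ⟦ v ≡ᵇ c ⟧
⟦inTriᵇ⟧ {a} {b} {c} a≢b b≢c a≢c v with v ≡ᵇ a in va | v ≡ᵇ b in vb | v ≡ᵇ c in vc
... | true  | true  | _     = ⊥-elim (a≢b (trans (sym (≡ᵇ-true⇒≡ {v} va)) (≡ᵇ-true⇒≡ {v} vb)))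
... | true  | false | true  = ⊥-elim (a≢c (trans (sym (≡ᵇ-true⇒≡ {v} va)) (≡ᵇ-true⇒≡ {v} vc)))
... | false | true  | true  = ⊥-elim (b≢c (trans (sym (≡ᵇ-true⇒≡ {v} vb)) (≡ᵇ-true⇒≡ {v} vc)))
... | true  | false | false = refl
... | false | true  | false = refl
... | false | false | true  = refl
... | false | false | false = refl

⟦<ᵇ+3⟧ : ∀ v n → ⟦ v <ᵇ n + 3 ⟧ ≡ ⟦ v ≡ᵇ n ⟧ + ⟦ v ≡ᵇ n + 1 ⟧ + ⟦ v ≡ᵇ n + 2 ⟧ + ⟦ v <ᵇ n ⟧
⟦<ᵇ+3⟧ zero zero = refl
⟦<ᵇ+3⟧ (suc zero) zero = refl
⟦<ᵇ+3⟧ (suc (suc zero)) zero = refl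
⟦<ᵇ+3⟧ (suc (suc (suc v))) zero = refl
⟦<ᵇ+3⟧ zero (suc n) = refl
⟦<ᵇ+3⟧ (suc v) (suc n) = ⟦<ᵇ+3⟧ v n

module _ {n : ℕ} {E : List Edge} (valid : All (ValidEdge n) E) where

  triangle-distinct : ∀ {a b c} → IsTriangle E (a , b , c) → a ≢ b × b ≢ c × a ≢ c
  triangle-distinct (ab , bc , ac) = distinct ab , distinct bc , distinct ac
    where
      distinct : ∀ {x y} → Adj E x y → x ≢ y
      distinct = proj₂ ∘ proj₂ ∘ adj-valid valid

  ⟦inTriᵇ⟧-triangle : ∀ {a b c} → IsTriangle E (a , b , c) → ∀ v →
                      ⟦ inTriᵇ v (a , b , c) ⟧ ≡ ⟦ v ≡ᵇ a ⟧ + ⟦ v ≡ᵇ b ⟧ + ⟦ v ≡ᵇ c ⟧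
  ⟦inTriᵇ⟧-triangle abc with triangle-distinct abc
  ... | a≢b , b≢c , a≢c = ⟦inTriᵇ⟧ a≢b b≢c a≢c

triangle-adj : ∀ {E a b c x y} → IsTriangle E (a , b , c) →
               T (inTriᵇ x (a , b , c)) → T (inTriᵇ y (a , b , c)) → x ≢ y → Adj E x y
triangle-adj {a = a} {b} {c} {x} {y} (ab , bc , ac) x∈t y∈t x≢y
  with inTriᵇ⇒ {x} {a} {b} {c} x∈t | inTriᵇ⇒ {y} {a} {b} {c} y∈t
... | inj₁ refl        | inj₁ refl        = ⊥-elim (x≢y refl)
... | inj₁ refl        | inj₂ (inj₁ refl) = ab
... | inj₁ refl        | inj₂ (inj₂ refl) = ac
... | inj₂ (inj₁ refl) | inj₁ refl        = adj-sym ab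
... | inj₂ (inj₁ refl) | inj₂ (inj₁ refl) = ⊥-elim (x≢y refl)
... | inj₂ (inj₁ refl) | inj₂ (inj₂ refl) = bc
... | inj₂ (inj₂ refl) | inj₁ refl        = adj-sym ac
... | inj₂ (inj₂ refl) | inj₂ (inj₁ refl) = adj-sym bc
... | inj₂ (inj₂ refl) | inj₂ (inj₂ refl) = ⊥-elim (x≢y refl)

module _ {t : Tri} {v₁ v₂ v₃ : ℕ} where

  split-triangle : ∀ {E} → Split t v₁ v₂ v₃ → IsTriangle E t → IsTriangle E (v₁ , v₂ , v₃)
  split-triangle split₃ abc = abc
  split-triangle split₁ (ab , bc , ac) = bc , adj-sym ac , adj-sym ab
  split-triangle split₂ (ab , bc , ac) = ac , adj-sym bc , ab

  split-inTriᵇ : Split t v₁ v₂ v₃ → ∀ v → inTriᵇ v t ≡ inTriᵇ v (v₁ , v₂ , v₃)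
  split-inTriᵇ split₃ v = refl
  split-inTriᵇ split₁ v = trans (∨-comm (v ≡ᵇ v₃) _) (∨-assoc (v ≡ᵇ v₁) _ _)
  split-inTriᵇ split₂ v = cong ((v ≡ᵇ v₁) ∨_) (∨-comm (v ≡ᵇ v₃) (v ≡ᵇ v₂))

module _ {A : Set} (p : A → Bool) where

  length-filterᵇ-∷ : ∀ x xs → length (filterᵇ p (x ∷ xs)) ≡ ⟦ p x ⟧ + length (filterᵇ p xs)
  length-filterᵇ-∷ x xs with p x
  ... | true  = refl
  ... | false = refl

  length-filterᵇ-─ : ∀ {x xs} (x∈xs : x ∈ xs) →
                     length (filterᵇ p xs) ≡ ⟦ p x ⟧ + length (filterᵇ p (xs ─ x∈xs))
  length-filterᵇ-─ {xs = y ∷ ys} (here refl) = length-filterᵇ-∷ y ys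
  length-filterᵇ-─ {x} {y ∷ ys} (there x∈ys) = begin
    length (filterᵇ p (y ∷ ys))                  ≡⟨ length-filterᵇ-∷ y ys ⟩
    ⟦ p y ⟧ + length (filterᵇ p ys)               ≡⟨ cong (⟦ p y ⟧ +_) (length-filterᵇ-─ x∈ys) ⟩
    ⟦ p y ⟧ + (⟦ p x ⟧ + length (filterᵇ p rest)) ≡⟨ x∙yz≈y∙xz ⟦ p y ⟧ ⟦ p x ⟧ _ ⟩
    ⟦ p x ⟧ + (⟦ p y ⟧ + length (filterᵇ p rest)) ≡⟨ cong (⟦ p x ⟧ +_) (sym (length-filterᵇ-∷ y rest)) ⟩
    ⟦ p x ⟧ + length (filterᵇ p (y ∷ rest))       ∎
    where
      open ≡-Reasoning
      rest : List A
      rest = ys ─ x∈ys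

  any-filterᵇ : ∀ xs → 0 < length (filterᵇ p xs) → Any (T ∘ p) xs
  any-filterᵇ (x ∷ xs) pos with p x in px
  ... | true  = here (subst T (sym px) tt)
  ... | false = there (any-filterᵇ xs pos)

-- Independent sets

module _ {A B : Set} (_◃_ : A → B → Set) where

  any-─ : ∀ {x y bs} (x◃ : Any (x ◃_) bs) → Any (y ◃_) bs →
          (∀ {b} → x ◃ b → y ◃ b → ⊥) → Any (y ◃_) (bs ─ x◃)
  any-─ (here x◃b) (here y◃b) apart = ⊥-elim (apart x◃b y◃b)
  any-─ (here _)   (there y◃)  _    = y◃
  any-─ (there _)  (here y◃b)  _    = here y◃b
  any-─ (there x◃) (there y◃) apart = there (any-─ x◃ y◃ apart)

  length-≤-blocks : ∀ {xs bs} → All (λ x → Any (x ◃_) bs) xs →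
                    AllPairs (λ x y → ∀ {b} → x ◃ b → y ◃ b → ⊥) xs → length xs ≤ length bs
  length-≤-blocks [] [] = z≤n
  length-≤-blocks {x ∷ xs} {bs} (x◃ ∷ xs◃) (x-apart ∷ apart) =
    subst (suc (length xs) ≤_) (sym (length-removeAt′ bs (index x◃)))
      (s≤s (length-≤-blocks (All.zipWith outside-x◃ (xs◃ , x-apart)) apart))
    where
      outside-x◃ : ∀ {y} → Any (y ◃_) bs × (∀ {b} → x ◃ b → y ◃ b → ⊥) → Any (y ◃_) (bs ─ x◃)
      outside-x◃ (y◃ , x-apart-y) = any-─ x◃ y◃ x-apart-y

independent-adj : ∀ {n E S a b} → Independent n E S → a ∈ S → b ∈ S → Adj E a b → a ≡ b
independent-adj _                   (here refl) (here refl) _   = refl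
independent-adj (_ , _ , a≁S ∷ _)   (here refl) (there b∈S) ab  = ⊥-elim (All.lookup a≁S b∈S ab)
independent-adj (_ , _ , b≁S ∷ _)   (there a∈S) (here refl) ab  = ⊥-elim (All.lookup b≁S a∈S (adj-sym ab))
independent-adj (_ ∷ S<n , _ ∷ distinct , _ ∷ indep) (there a∈S) (there b∈S) ab =
  independent-adj (S<n , distinct , indep) a∈S b∈S ab

∉-neighbour : ∀ {n E S z x} → All (ValidEdge n) E → Independent n E S → z ∈ S → Adj E z x → x ∉ S
∉-neighbour valid ind z∈S zx x∈S = proj₂ (proj₂ (adj-valid valid zx)) (independent-adj ind z∈S x∈S zx)

independent-≤-cover : ∀ {n E C S} → PerfectThreeCover n E C → Independent n E S → length S ≤ length C
independent-≤-cover {n} {E} {C} (triangles , once) (S<n , distinct , indep) =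
  length-≤-blocks _◃_ (All.map covered S<n) (AllPairs.zipWith apart (distinct , indep))
  where
    _◃_ : ℕ → Tri → Set
    v ◃ t = T (inTriᵇ v t) × IsTriangle E t

    with-triangle : ∀ {v ts} → All (IsTriangle E) ts → Any (T ∘ inTriᵇ v) ts → Any (v ◃_) ts
    with-triangle (abc ∷ _)   (here v∈t) = here (v∈t , abc)
    with-triangle {v} (_ ∷ tris) (there v∈) = there (with-triangle {v} tris v∈)

    covered : ∀ {v} → v < n → Any (v ◃_) C
    covered {v} v<n = with-triangle {v} triangles
      (any-filterᵇ (inTriᵇ v) C (subst (0 <_) (sym (once v v<n)) z<s))

    apart : ∀ {a b} → a ≢ b × ¬ Adj E a b → ∀ {t} → a ◃ t → b ◃ t → ⊥
    apart (a≢b , a≁b) {x , y , z} (a∈t , xyz) (b∈t , _) = a≁b (triangle-adj xyz a∈t b∈t a≢b)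

large-independent⇒alphaSet : ∀ {n E C S} → PerfectThreeCover n E C → Independent n E S →
                             length S ≡ length C → AlphaSet n E S
large-independent⇒alphaSet cover ind |S|≡|C| =
  ind , λ S′ ind′ → subst (length S′ ≤_) (sym |S|≡|C|) (independent-≤-cover cover ind′)

module _ {n m : ℕ} {E es : List Edge} (valid : All (ValidEdge n) E) (n≤m : n ≤ m)
         (no-old-edge : ∀ {a b} → a < n → b < n → ¬ Adj es a b) where

  adjoin : ∀ {S u} → Independent n E S → n ≤ u → u < m →
           (∀ {b} → b < n → Adj es u b → b ∉ S) → Independent m (es ++ E) (u ∷ S)
  adjoin {S} {u} (S<n , distinct , indep) n≤u u<m neighbours∉S =
      (u<m ∷ All.map (λ b<n → <-≤-trans b<n n≤m) S<n)
    , (¬Any⇒All¬ S u∉S ∷ distinct)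
    , (All.tabulate u≁S ∷ non-adjacent S<n indep)
    where
      u∉S : u ∉ S
      u∉S u∈S = <⇒≱ (All.lookup S<n u∈S) n≤u

      u≁S : ∀ {b} → b ∈ S → ¬ Adj (es ++ E) u b
      u≁S b∈S ub with adj-++⁻ es ub
      ... | inj₁ ub-new = neighbours∉S (All.lookup S<n b∈S) ub-new b∈S
      ... | inj₂ ub-old = <⇒≱ (proj₁ (adj-valid valid ub-old)) n≤u

      non-adjacent : ∀ {S} → All (_< n) S → AllPairs (λ a b → ¬ Adj E a b) S →
                     AllPairs (λ a b → ¬ Adj (es ++ E) a b) S
      non-adjacent [] [] = []
      non-adjacent (a<n ∷ S<n) (a≁S ∷ indep) =
        All.zipWith (λ (b<n , a≁b) → [ no-old-edge a<n b<n , a≁b ]′ ∘ adj-++⁻ es) (S<n , a≁S)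
        ∷ non-adjacent S<n indep

-- The invariant

Through : ℕ → List Edge → ℕ → ℕ → Set
Through n E k v = ∃[ S ] Independent n E S × length S ≡ k × v ∈ S

Avoiding : ℕ → List Edge → ℕ → ℕ → ℕ → Set
Avoiding n E k x y = ∃[ S ] Independent n E S × length S ≡ k × x ∉ S × y ∉ S

record Invariant (n : ℕ) (E : List Edge) (R : List Tri) : Set where
  field
    valid         : All (ValidEdge n) E
    common        : ∀ {x y} → Adj E x y → CommonNeighbour E x y
    red-triangles : All (IsTriangle E) R
    -- vertices ≥ n must be uncovered: the next operation names its new vertices n, n + 1, n + 2
    red-cover     : ∀ v → occurrences v R ≡ ⟦ v <ᵇ n ⟧
    through       : ∀ {v} → v < n → Through n E (length R) v

  avoiding : ∀ {x y} → Adj E x y → Avoiding n E (length R) x y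
  avoiding xy =
    let z , xz , yz         = common xy
        S , ind , len , z∈S = through (proj₁ (proj₂ (adj-valid valid xz)))
    in S , ind , len , ∉-neighbour valid ind z∈S (adj-sym xz) , ∉-neighbour valid ind z∈S (adj-sym yz)

  perfect-cover : PerfectThreeCover n E R
  perfect-cover = red-triangles , λ v v<n → trans (red-cover v) (⟦T⟧ (<⇒<ᵇ v<n))
    where
      ⟦T⟧ : ∀ {b} → T b → ⟦ b ⟧ ≡ 1
      ⟦T⟧ {true} _ = refl

E₀ : List Edge
E₀ = (0 , 1) ∷ (0 , 2) ∷ (1 , 2) ∷ []

base-invariant : Invariant 3 E₀ ((0 , 1 , 2) ∷ [])
base-invariant = record
  { valid         = (z<s , 1<3 , λ ()) ∷ (z<s , 2<3 , λ ()) ∷ (1<3 , 2<3 , λ ()) ∷ []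
  ; common        = common-++ E₀ (λ { (inj₁ ()) ; (inj₂ ()) }) common-E₀
  ; red-triangles = (0~1 , 1~2 , 0~2) ∷ []
  ; red-cover     = cover
  ; through       = λ {v} v<3 → v ∷ [] , (v<3 ∷ [] , [] ∷ [] , [] ∷ []) , refl , here refl
  }
  where
    1<3 : 1 < 3
    1<3 = s≤s z<s
    2<3 : 2 < 3
    2<3 = s≤s (s≤s z<s)
    0~1 : Adj E₀ 0 1
    0~1 = inj₁ ∈₁
    0~2 : Adj E₀ 0 2
    0~2 = inj₁ ∈₂
    1~2 : Adj E₀ 1 2
    1~2 = inj₁ ∈₃
    common-E₀ : ∀ {x y} → (x , y) ∈ E₀ → CommonNeighbour E₀ x y
    common-E₀ ∈₁ = 2 , 0~2 , 1~2
    common-E₀ ∈₂ = 1 , 0~1 , adj-sym 1~2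
    common-E₀ ∈₃ = 0 , adj-sym 0~1 , adj-sym 0~2
    cover : ∀ v → occurrences v ((0 , 1 , 2) ∷ []) ≡ ⟦ v <ᵇ 3 ⟧
    cover 0 = refl
    cover 1 = refl
    cover 2 = refl
    cover (suc (suc (suc _))) = refl

-- The operation 𝓞₁

module Op₁ {n : ℕ} {E : List Edge} {R : List Tri} (I : Invariant n E R)
           {v₁ v₂ : ℕ} (v₁~v₂ : Adj E v₁ v₂) where
  open Invariant I

  u₀ u₁ u₂ : ℕ
  u₀ = n
  u₁ = n + 1
  u₂ = n + 2

  es : List Edge
  es = (v₁ , u₀) ∷ (v₂ , u₀) ∷ (v₂ , u₁) ∷ (u₀ , u₁) ∷ (u₀ , u₂) ∷ (u₁ , u₂) ∷ []

  E′ : List Edge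
  E′ = es ++ E

  R′ : List Tri
  R′ = (u₀ , u₁ , u₂) ∷ R

  v₁<n : v₁ < n
  v₁<n = proj₁ (adj-valid valid v₁~v₂)

  v₂<n : v₂ < n
  v₂<n = proj₁ (proj₂ (adj-valid valid v₁~v₂))

  old-neighbour : ∀ {u b} → b < n → Adj es u b → u ≡ u₀ × (b ≡ v₁ ⊎ b ≡ v₂) ⊎ u ≡ u₁ × b ≡ v₂
  old-neighbour b<n (inj₁ ∈₁) = ⊥-elim (n≮n n b<n)
  old-neighbour b<n (inj₁ ∈₂) = ⊥-elim (n≮n n b<n)
  old-neighbour b<n (inj₁ ∈₃) = ⊥-elim (m+n≮m n 1 b<n)
  old-neighbour b<n (inj₁ ∈₄) = ⊥-elim (m+n≮m n 1 b<n)
  old-neighbour b<n (inj₁ ∈₅) = ⊥-elim (m+n≮m n 2 b<n)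
  old-neighbour b<n (inj₁ ∈₆) = ⊥-elim (m+n≮m n 2 b<n)
  old-neighbour b<n (inj₂ ∈₁) = inj₁ (refl , inj₁ refl)
  old-neighbour b<n (inj₂ ∈₂) = inj₁ (refl , inj₂ refl)
  old-neighbour b<n (inj₂ ∈₃) = inj₂ (refl , refl)
  old-neighbour b<n (inj₂ ∈₄) = ⊥-elim (n≮n n b<n)
  old-neighbour b<n (inj₂ ∈₅) = ⊥-elim (n≮n n b<n)
  old-neighbour b<n (inj₂ ∈₆) = ⊥-elim (m+n≮m n 1 b<n)

  no-old-edge : ∀ {a b} → a < n → b < n → ¬ Adj es a b
  no-old-edge a<n b<n ab with old-neighbour b<n ab
  ... | inj₁ (refl , _) = n≮n n a<n
  ... | inj₂ (refl , _) = m+n≮m n 1 a<n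

  adjoin₀ : ∀ {S} → Independent n E S → v₁ ∉ S → v₂ ∉ S → Independent (n + 3) E′ (u₀ ∷ S)
  adjoin₀ ind v₁∉S v₂∉S = adjoin valid (m≤m+n n 3) no-old-edge ind ≤-refl (n<n+3 n) λ b<n ub →
    case old-neighbour b<n ub of λ where
      (inj₁ (_ , inj₁ refl)) → v₁∉S
      (inj₁ (_ , inj₂ refl)) → v₂∉S
      (inj₂ (u₀≡u₁ , _))     → ⊥-elim (n≢n+1 n u₀≡u₁)

  adjoin₁ : ∀ {S} → Independent n E S → v₂ ∉ S → Independent (n + 3) E′ (u₁ ∷ S)
  adjoin₁ ind v₂∉S = adjoin valid (m≤m+n n 3) no-old-edge ind (m≤m+n n 1) (n+1<n+3 n) λ b<n ub →
    case old-neighbour b<n ub of λ where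
      (inj₁ (u₁≡u₀ , _)) → ⊥-elim (n≢n+1 n (sym u₁≡u₀))
      (inj₂ (_ , refl))  → v₂∉S

  adjoin₂ : ∀ {S} → Independent n E S → Independent (n + 3) E′ (u₂ ∷ S)
  adjoin₂ ind = adjoin valid (m≤m+n n 3) no-old-edge ind (m≤m+n n 2) (n+2<n+3 n) λ b<n ub →
    case old-neighbour b<n ub of λ where
      (inj₁ (u₂≡u₀ , _)) → ⊥-elim (n≢n+2 n (sym u₂≡u₀))
      (inj₂ (u₂≡u₁ , _)) → ⊥-elim (n+1≢n+2 n (sym u₂≡u₁))

  valid′ : All (ValidEdge (n + 3)) E′
  valid′ = (<⇒<+3 v₁<n , n<n+3 n , <⇒≢ v₁<n)
         ∷ (<⇒<+3 v₂<n , n<n+3 n , <⇒≢ v₂<n)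
         ∷ (<⇒<+3 v₂<n , n+1<n+3 n , <-≤⇒≢ v₂<n (m≤m+n n 1))
         ∷ (n<n+3 n , n+1<n+3 n , n≢n+1 n)
         ∷ (n<n+3 n , n+2<n+3 n , n≢n+2 n)
         ∷ (n+1<n+3 n , n+2<n+3 n , n+1≢n+2 n)
         ∷ All.map (λ (a<n , b<n , a≢b) → <⇒<+3 a<n , <⇒<+3 b<n , a≢b) valid

  v₁~u₀ : Adj E′ v₁ u₀
  v₁~u₀ = inj₁ ∈₁
  v₂~u₀ : Adj E′ v₂ u₀
  v₂~u₀ = inj₁ ∈₂
  v₂~u₁ : Adj E′ v₂ u₁
  v₂~u₁ = inj₁ ∈₃
  u₀~u₁ : Adj E′ u₀ u₁
  u₀~u₁ = inj₁ ∈₄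
  u₀~u₂ : Adj E′ u₀ u₂
  u₀~u₂ = inj₁ ∈₅
  u₁~u₂ : Adj E′ u₁ u₂
  u₁~u₂ = inj₁ ∈₆

  common-new : ∀ {x y} → (x , y) ∈ es → CommonNeighbour E′ x y
  common-new ∈₁ = v₂ , adj-++⁺ʳ es v₁~v₂ , adj-sym v₂~u₀
  common-new ∈₂ = v₁ , adj-++⁺ʳ es (adj-sym v₁~v₂) , adj-sym v₁~u₀
  common-new ∈₃ = u₀ , v₂~u₀ , adj-sym u₀~u₁
  common-new ∈₄ = v₂ , adj-sym v₂~u₀ , adj-sym v₂~u₁
  common-new ∈₅ = u₁ , u₀~u₁ , adj-sym u₁~u₂
  common-new ∈₆ = u₀ , adj-sym u₀~u₁ , adj-sym u₀~u₂

  red-cover′ : ∀ v → occurrences v R′ ≡ ⟦ v <ᵇ n + 3 ⟧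
  red-cover′ v = begin
    occurrences v R′
      ≡⟨ length-filterᵇ-∷ (inTriᵇ v) _ R ⟩
    ⟦ inTriᵇ v (u₀ , u₁ , u₂) ⟧ + occurrences v R
      ≡⟨ cong₂ _+_ (⟦inTriᵇ⟧ (n≢n+1 n) (n+1≢n+2 n) (n≢n+2 n) v) (red-cover v) ⟩
    ⟦ v ≡ᵇ u₀ ⟧ + ⟦ v ≡ᵇ u₁ ⟧ + ⟦ v ≡ᵇ u₂ ⟧ + ⟦ v <ᵇ n ⟧
      ≡⟨ sym (⟦<ᵇ+3⟧ v n) ⟩
    ⟦ v <ᵇ n + 3 ⟧ ∎
    where open ≡-Reasoning

  through′ : ∀ {v} → v < n + 3 → Through (n + 3) E′ (length R′) v
  through′ v<n+3 with oldOrNew n v<n+3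
  ... | old v<n = let S , ind , len , v∈S = through v<n in
    u₂ ∷ S , adjoin₂ ind , cong suc len , there v∈S
  ... | new₀ = let S , ind , len , v₁∉S , v₂∉S = avoiding v₁~v₂ in
    u₀ ∷ S , adjoin₀ ind v₁∉S v₂∉S , cong suc len , here refl
  ... | new₁ = let S , ind , len , v₁∈S = through v₁<n in
    u₁ ∷ S , adjoin₁ ind (∉-neighbour valid ind v₁∈S v₁~v₂) , cong suc len , here refl
  ... | new₂ = let S , ind , len , _ = through v₁<n in
    u₂ ∷ S , adjoin₂ ind , cong suc len , here refl

  invariant′ : Invariant (n + 3) E′ R′
  invariant′ = record
    { valid         = valid′
    ; common        = common-++ es common common-new
    ; red-triangles = (u₀~u₁ , u₁~u₂ , u₀~u₂) ∷ All.map (triangle-++⁺ʳ es) red-triangles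
    ; red-cover     = red-cover′
    ; through       = through′
    }

-- The operation 𝓞₂

module Op₂ {n : ℕ} {E : List Edge} {R : List Tri} (I : Invariant n E R)
           {t : Tri} (t∈R : t ∈ R) {v₁ v₂ v₃ v₄ : ℕ} (split : Split t v₁ v₂ v₃)
           (v₃~v₄ : Adj E v₃ v₄) where
  open Invariant I

  u₀ u₁ u₂ : ℕ
  u₀ = n
  u₁ = n + 1
  u₂ = n + 2

  es : List Edge
  es = (u₀ , v₁) ∷ (u₀ , v₂) ∷ (v₃ , u₁) ∷ (v₄ , u₁) ∷ (v₃ , u₂) ∷ (u₁ , u₂) ∷ []

  E′ : List Edge
  E′ = es ++ E

  R′ : List Tri
  R′ = (u₀ , v₁ , v₂) ∷ (v₃ , u₁ , u₂) ∷ (R ─ t∈R)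

  v₁v₂v₃ : IsTriangle E (v₁ , v₂ , v₃)
  v₁v₂v₃ = split-triangle split (All.lookup red-triangles t∈R)

  v₁~v₂ : Adj E v₁ v₂
  v₁~v₂ = proj₁ v₁v₂v₃
  v₂~v₃ : Adj E v₂ v₃
  v₂~v₃ = proj₁ (proj₂ v₁v₂v₃)
  v₁~v₃ : Adj E v₁ v₃
  v₁~v₃ = proj₂ (proj₂ v₁v₂v₃)

  v₁<n : v₁ < n
  v₁<n = proj₁ (adj-valid valid v₁~v₂)
  v₂<n : v₂ < n
  v₂<n = proj₁ (adj-valid valid v₂~v₃)
  v₃<n : v₃ < n
  v₃<n = proj₁ (adj-valid valid v₃~v₄)
  v₄<n : v₄ < n
  v₄<n = proj₁ (proj₂ (adj-valid valid v₃~v₄))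

  old-neighbour : ∀ {u b} → b < n → Adj es u b →
                  u ≡ u₀ × (b ≡ v₁ ⊎ b ≡ v₂) ⊎ u ≡ u₁ × (b ≡ v₃ ⊎ b ≡ v₄) ⊎ u ≡ u₂ × b ≡ v₃
  old-neighbour b<n (inj₁ ∈₁) = inj₁ (refl , inj₁ refl)
  old-neighbour b<n (inj₁ ∈₂) = inj₁ (refl , inj₂ refl)
  old-neighbour b<n (inj₁ ∈₃) = ⊥-elim (m+n≮m n 1 b<n)
  old-neighbour b<n (inj₁ ∈₄) = ⊥-elim (m+n≮m n 1 b<n)
  old-neighbour b<n (inj₁ ∈₅) = ⊥-elim (m+n≮m n 2 b<n)
  old-neighbour b<n (inj₁ ∈₆) = ⊥-elim (m+n≮m n 2 b<n)
  old-neighbour b<n (inj₂ ∈₁) = ⊥-elim (n≮n n b<n)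
  old-neighbour b<n (inj₂ ∈₂) = ⊥-elim (n≮n n b<n)
  old-neighbour b<n (inj₂ ∈₃) = inj₂ (inj₁ (refl , inj₁ refl))
  old-neighbour b<n (inj₂ ∈₄) = inj₂ (inj₁ (refl , inj₂ refl))
  old-neighbour b<n (inj₂ ∈₅) = inj₂ (inj₂ (refl , refl))
  old-neighbour b<n (inj₂ ∈₆) = ⊥-elim (m+n≮m n 1 b<n)

  no-old-edge : ∀ {a b} → a < n → b < n → ¬ Adj es a b
  no-old-edge a<n b<n ab with old-neighbour b<n ab
  ... | inj₁ (refl , _)        = n≮n n a<n
  ... | inj₂ (inj₁ (refl , _)) = m+n≮m n 1 a<n
  ... | inj₂ (inj₂ (refl , _)) = m+n≮m n 2 a<n

  adjoin₀ : ∀ {S} → Independent n E S → v₁ ∉ S → v₂ ∉ S → Independent (n + 3) E′ (u₀ ∷ S)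
  adjoin₀ ind v₁∉S v₂∉S = adjoin valid (m≤m+n n 3) no-old-edge ind ≤-refl (n<n+3 n) λ b<n ub →
    case old-neighbour b<n ub of λ where
      (inj₁ (_ , inj₁ refl))        → v₁∉S
      (inj₁ (_ , inj₂ refl))        → v₂∉S
      (inj₂ (inj₁ (u₀≡u₁ , _)))     → ⊥-elim (n≢n+1 n u₀≡u₁)
      (inj₂ (inj₂ (u₀≡u₂ , _)))     → ⊥-elim (n≢n+2 n u₀≡u₂)

  adjoin₁ : ∀ {S} → Independent n E S → v₃ ∉ S → v₄ ∉ S → Independent (n + 3) E′ (u₁ ∷ S)
  adjoin₁ ind v₃∉S v₄∉S = adjoin valid (m≤m+n n 3) no-old-edge ind (m≤m+n n 1) (n+1<n+3 n) λ b<n ub →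
    case old-neighbour b<n ub of λ where
      (inj₁ (u₁≡u₀ , _))            → ⊥-elim (n≢n+1 n (sym u₁≡u₀))
      (inj₂ (inj₁ (_ , inj₁ refl))) → v₃∉S
      (inj₂ (inj₁ (_ , inj₂ refl))) → v₄∉S
      (inj₂ (inj₂ (u₁≡u₂ , _)))     → ⊥-elim (n+1≢n+2 n u₁≡u₂)

  adjoin₂ : ∀ {S} → Independent n E S → v₃ ∉ S → Independent (n + 3) E′ (u₂ ∷ S)
  adjoin₂ ind v₃∉S = adjoin valid (m≤m+n n 3) no-old-edge ind (m≤m+n n 2) (n+2<n+3 n) λ b<n ub →
    case old-neighbour b<n ub of λ where
      (inj₁ (u₂≡u₀ , _))            → ⊥-elim (n≢n+2 n (sym u₂≡u₀))
      (inj₂ (inj₁ (u₂≡u₁ , _)))     → ⊥-elim (n+1≢n+2 n (sym u₂≡u₁))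
      (inj₂ (inj₂ (_ , refl)))      → v₃∉S

  adjoin-some : ∀ {S} → Independent n E S → ∃[ u ] Independent (n + 3) E′ (u ∷ S)
  adjoin-some {S} ind with v₃ ∈? S
  ... | yes v₃∈S = u₀ , adjoin₀ ind (∉-neighbour valid ind v₃∈S (adj-sym v₁~v₃))
                                    (∉-neighbour valid ind v₃∈S (adj-sym v₂~v₃))
  ... | no  v₃∉S = u₂ , adjoin₂ ind v₃∉S

  valid′ : All (ValidEdge (n + 3)) E′
  valid′ = (n<n+3 n , <⇒<+3 v₁<n , ≢-sym (<⇒≢ v₁<n))
         ∷ (n<n+3 n , <⇒<+3 v₂<n , ≢-sym (<⇒≢ v₂<n))
         ∷ (<⇒<+3 v₃<n , n+1<n+3 n , <-≤⇒≢ v₃<n (m≤m+n n 1))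
         ∷ (<⇒<+3 v₄<n , n+1<n+3 n , <-≤⇒≢ v₄<n (m≤m+n n 1))
         ∷ (<⇒<+3 v₃<n , n+2<n+3 n , <-≤⇒≢ v₃<n (m≤m+n n 2))
         ∷ (n+1<n+3 n , n+2<n+3 n , n+1≢n+2 n)
         ∷ All.map (λ (a<n , b<n , a≢b) → <⇒<+3 a<n , <⇒<+3 b<n , a≢b) valid

  u₀~v₁ : Adj E′ u₀ v₁
  u₀~v₁ = inj₁ ∈₁
  u₀~v₂ : Adj E′ u₀ v₂
  u₀~v₂ = inj₁ ∈₂
  v₃~u₁ : Adj E′ v₃ u₁
  v₃~u₁ = inj₁ ∈₃
  v₄~u₁ : Adj E′ v₄ u₁
  v₄~u₁ = inj₁ ∈₄
  v₃~u₂ : Adj E′ v₃ u₂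
  v₃~u₂ = inj₁ ∈₅
  u₁~u₂ : Adj E′ u₁ u₂
  u₁~u₂ = inj₁ ∈₆

  common-new : ∀ {x y} → (x , y) ∈ es → CommonNeighbour E′ x y
  common-new ∈₁ = v₂ , u₀~v₂ , adj-++⁺ʳ es v₁~v₂
  common-new ∈₂ = v₁ , u₀~v₁ , adj-++⁺ʳ es (adj-sym v₁~v₂)
  common-new ∈₃ = v₄ , adj-++⁺ʳ es v₃~v₄ , adj-sym v₄~u₁
  common-new ∈₄ = v₃ , adj-++⁺ʳ es (adj-sym v₃~v₄) , adj-sym v₃~u₁
  common-new ∈₅ = u₁ , v₃~u₁ , adj-sym u₁~u₂
  common-new ∈₆ = v₃ , adj-sym v₃~u₁ , adj-sym v₃~u₂

  u₀v₁v₂ : IsTriangle E′ (u₀ , v₁ , v₂)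
  u₀v₁v₂ = u₀~v₁ , adj-++⁺ʳ es v₁~v₂ , u₀~v₂

  v₃u₁u₂ : IsTriangle E′ (v₃ , u₁ , u₂)
  v₃u₁u₂ = v₃~u₁ , u₁~u₂ , v₃~u₂

  -- The two new red triangles cover exactly the vertices of t and the three new vertices.
  red-cover′ : ∀ v → occurrences v R′ ≡ ⟦ v <ᵇ n + 3 ⟧
  red-cover′ v = begin
    occurrences v R′
      ≡⟨ length-filterᵇ-∷ (inTriᵇ v) _ _ ⟩
    ⟦ inTriᵇ v (u₀ , v₁ , v₂) ⟧ + occurrences v ((v₃ , u₁ , u₂) ∷ (R ─ t∈R))
      ≡⟨ cong₂ _+_ (⟦inTriᵇ⟧-triangle valid′ u₀v₁v₂ v) (length-filterᵇ-∷ (inTriᵇ v) _ _) ⟩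
    (δ u₀ + δ v₁ + δ v₂) + (⟦ inTriᵇ v (v₃ , u₁ , u₂) ⟧ + m)
      ≡⟨ cong (λ k → (δ u₀ + δ v₁ + δ v₂) + (k + m)) (⟦inTriᵇ⟧-triangle valid′ v₃u₁u₂ v) ⟩
    (δ u₀ + δ v₁ + δ v₂) + ((δ v₃ + δ u₁ + δ u₂) + m)
      ≡⟨ regroup (δ u₀) (δ v₁) (δ v₂) (δ v₃) (δ u₁) (δ u₂) m ⟩
    (δ u₀ + δ u₁ + δ u₂) + ((δ v₁ + δ v₂ + δ v₃) + m)
      ≡⟨ cong (λ k → (δ u₀ + δ u₁ + δ u₂) + (k + m)) (sym ⟦inTriᵇ⟧-t) ⟩
    (δ u₀ + δ u₁ + δ u₂) + (⟦ inTriᵇ v t ⟧ + m)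
      ≡⟨ cong ((δ u₀ + δ u₁ + δ u₂) +_) (sym (length-filterᵇ-─ (inTriᵇ v) t∈R)) ⟩
    (δ u₀ + δ u₁ + δ u₂) + occurrences v R
      ≡⟨ cong ((δ u₀ + δ u₁ + δ u₂) +_) (red-cover v) ⟩
    (δ u₀ + δ u₁ + δ u₂) + ⟦ v <ᵇ n ⟧
      ≡⟨ sym (⟦<ᵇ+3⟧ v n) ⟩
    ⟦ v <ᵇ n + 3 ⟧ ∎
    where
      open ≡-Reasoning
      open +-*-Solver using (solve; _:+_; _:=_)
      δ : ℕ → ℕ
      δ w = ⟦ v ≡ᵇ w ⟧
      m : ℕ
      m = occurrences v (R ─ t∈R)
      ⟦inTriᵇ⟧-t : ⟦ inTriᵇ v t ⟧ ≡ δ v₁ + δ v₂ + δ v₃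
      ⟦inTriᵇ⟧-t = trans (cong ⟦_⟧ (split-inTriᵇ split v)) (⟦inTriᵇ⟧-triangle valid v₁v₂v₃ v)
      regroup : ∀ a b c d e f x → (a + b + c) + ((d + e + f) + x) ≡ (a + e + f) + ((b + c + d) + x)
      regroup = solve 7 (λ a b c d e f x → (a :+ b :+ c) :+ ((d :+ e :+ f) :+ x)
                                          := (a :+ e :+ f) :+ ((b :+ c :+ d) :+ x)) refl

  through′ : ∀ {v} → v < n + 3 → Through (n + 3) E′ (suc (length R)) v
  through′ v<n+3 with oldOrNew n v<n+3
  ... | old v<n = let S , ind , len , v∈S = through v<n ; u , ind′ = adjoin-some ind in
    u ∷ S , ind′ , cong suc len , there v∈S
  ... | new₀ = let S , ind , len , v₃∈S = through v₃<n in
    u₀ ∷ S , adjoin₀ ind (∉-neighbour valid ind v₃∈S (adj-sym v₁~v₃))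
                         (∉-neighbour valid ind v₃∈S (adj-sym v₂~v₃))
           , cong suc len , here refl
  ... | new₁ = let S , ind , len , v₃∉S , v₄∉S = avoiding v₃~v₄ in
    u₁ ∷ S , adjoin₁ ind v₃∉S v₄∉S , cong suc len , here refl
  ... | new₂ = let S , ind , len , v₁∈S = through v₁<n in
    u₂ ∷ S , adjoin₂ ind (∉-neighbour valid ind v₁∈S v₁~v₃) , cong suc len , here refl

  length-R′ : suc (length R) ≡ length R′
  length-R′ = cong suc (length-removeAt′ R (index t∈R))

  invariant′ : Invariant (n + 3) E′ R′
  invariant′ = record
    { valid         = valid′
    ; common        = common-++ es common common-new
    ; red-triangles = u₀v₁v₂ ∷ v₃u₁u₂ ∷ ─⁺ t∈R (All.map (triangle-++⁺ʳ es) red-triangles)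
    ; red-cover     = red-cover′
    ; through       = λ {v} → subst (λ k → Through (n + 3) E′ k v) length-R′ ∘ through′
    }

invariant : ∀ {n E R B} → InE n E R B → Invariant n E R
invariant base = base-invariant
invariant (op₁ _ _ G v₁~v₂) = Op₁.invariant′ (invariant G) v₁~v₂
invariant (op₂ t∈R _ _ _ _ G split v₃~v₄) = Op₂.invariant′ (invariant G) t∈R split v₃~v₄

proposition3 : (n : ℕ) (E : List Edge) → InFamilyE n E →
               (∃[ T ] PerfectThreeCover n E T) × AlphaExcellent n E
proposition3 n E (R , _ , G) = (R , perfect-cover) , excellent
  where
    open Invariant (invariant G)
    excellent : AlphaExcellent n E
    excellent v v<n = let S , ind , |S|≡|R| , v∈S = through v<n in
      S , large-independent⇒alphaSet perfect-cover ind |S|≡|R| , v∈S
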